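{- Consider a partial packing of the three bins $A,B,C$ (all current loads at most $22$) such that $s(A)+s(B)\ge 26$, with $s(C)$ arbitrary. Then there exists an online algorithm that, continuing from this partial packing, packs all remaining items of the input sequence into the three bins so that every bin has load at most $22$.
   Context: Scaled setting of Online Bin Stretching with three bins: items with sizes in $[0,16]$ arrive online one by one and each must be packed immediately and irrevocably into one of three bins $A,B,C$; it is guaranteed that the whole input sequence (items already packed together with all future items) can be packed offline into three bins of capacity $16$. A partial packing is an assignment of each item of some prefix of the input sequence (the items arrived so far) to one of the bins $A,B,C$. For a bin $X$, $s(X)$ denotes the total size of items currently assigned to $X$. The online algorithm must handle every possible continuation of the input satisfying the guarantee.
   Formalization: The item sizes, both in the given partial packing and in every continuation of the input, are rational numbers in $[0,16]$. -}

module Defs where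

open import Data.Nat using (ℕ)
open import Data.Integer using (+_)
open import Data.Rational using (ℚ; _/_; _+_; _≤_; 0ℚ)
open import Data.List using (List; []; _∷_; map; _++_)
open import Data.List.Relation.Unary.All using (All)
open import Data.Product using (_×_; _,_; proj₁; proj₂; ∃)
open import Relation.Binary.PropositionalEquality using (_≡_)

data Bin : Set where
  A B C : Bin

Size : Set
Size = ℚ

q : ℕ → ℚ
q n = + n / 1

InRange : Size → Set
InRange x = (0ℚ ≤ x) × (x ≤ q 16)

Packing : Set
Packing = List (Bin × Size)

sameBin : Bin → Bin → ℚ → ℚ
sameBin A A x = x
sameBin B B x = x
sameBin C C x = x
sameBin _ _ x = 0ℚ

load : Bin → Packing → ℚ
load X [] = 0ℚ
load X ((Y , x) ∷ p) = sameBin X Y x + load X p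

items : Packing → List Size
items = map proj₂

Packable16 : List Size → Set
Packable16 xs = ∃ λ (p : Packing) → (items p ≡ xs) × ((X : Bin) → load X p ≤ q 16)

-- An online algorithm: given the current packing (full history, most recent
-- item first) and the size of the newly arrived item, choose a bin.
OnlineAlg : Set
OnlineAlg = Packing → Size → Bin

run : OnlineAlg → Packing → List Size → Packing
run alg p [] = p
run alg p (x ∷ xs) = run alg ((alg p x , x) ∷ p) xs

-- Put every remaining item into C. The whole input fits into
-- three bins of capacity 16, so its total volume is at most 48; as A and B
-- already hold at least 26 of it, C ends with at most 48 - 26 = 22.
module Submission where

open import Defs
open import Data.Rational using (ℚ; 0ℚ; _+_; _-_; _≤_)
open import Data.Rational.Properties
  using (+-assoc; +-identityˡ; +-identityʳ; +-mono-≤; neg-antimono-≤; module ≤-Reasoning)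
open import Data.Rational.Solver using (module +-*-Solver)
open import Data.List using (List; []; _∷_; _++_; foldr)
open import Data.List.Relation.Unary.All using (All)
open import Data.Product using (_,_; ∃; proj₂)
open import Relation.Binary.PropositionalEquality
  using (_≡_; _≢_; refl; sym; trans; cong; cong₂; subst; module ≡-Reasoning)

open +-*-Solver

total : List ℚ → ℚ
total = foldr _+_ 0ℚ

total-++ : (xs ys : List ℚ) → total (xs ++ ys) ≡ total xs + total ys
total-++ []       ys = sym (+-identityˡ (total ys))
total-++ (x ∷ xs) ys = trans (cong (x +_) (total-++ xs ys)) (sym (+-assoc x (total xs) (total ys)))

sameBin-self : (X : Bin) (x : ℚ) → sameBin X X x ≡ x
sameBin-self A x = refl
sameBin-self B x = refl
sameBin-self C x = refl

sameBin-≢ : {X Y : Bin} → X ≢ Y → (x : ℚ) → sameBin X Y x ≡ 0ℚ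
sameBin-≢ {A} {A} X≢Y x with () ← X≢Y refl
sameBin-≢ {A} {B} X≢Y x = refl
sameBin-≢ {A} {C} X≢Y x = refl
sameBin-≢ {B} {A} X≢Y x = refl
sameBin-≢ {B} {B} X≢Y x with () ← X≢Y refl
sameBin-≢ {B} {C} X≢Y x = refl
sameBin-≢ {C} {A} X≢Y x = refl
sameBin-≢ {C} {B} X≢Y x = refl
sameBin-≢ {C} {C} X≢Y x with () ← X≢Y refl

sameBin-partition : (Y : Bin) (x : ℚ) → sameBin A Y x + sameBin B Y x + sameBin C Y x ≡ x
sameBin-partition A x = trans (+-identityʳ (x + 0ℚ)) (+-identityʳ x)
sameBin-partition B x = trans (+-identityʳ (0ℚ + x)) (+-identityˡ x)
sameBin-partition C x = trans (cong (_+ x) (+-identityˡ 0ℚ)) (+-identityˡ x)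

load-total : (p : Packing) → load A p + load B p + load C p ≡ total (items p)
load-total []            = refl
load-total ((Y , x) ∷ p) = begin
  (a + la) + (b + lb) + (c + lc)  ≡⟨ interchange a b c la lb lc ⟩
  (a + b + c) + (la + lb + lc)    ≡⟨ cong₂ _+_ (sameBin-partition Y x) (load-total p) ⟩
  x + total (items p)             ∎
  where
  open ≡-Reasoning
  a = sameBin A Y x; b = sameBin B Y x; c = sameBin C Y x
  la = load A p; lb = load B p; lc = load C p
  interchange : (a b c la lb lc : ℚ) → (a + la) + (b + lb) + (c + lc) ≡ (a + b + c) + (la + lb + lc)
  interchange = solve 6 (λ a b c la lb lc →
    (a :+ la) :+ (b :+ lb) :+ (c :+ lc) := (a :+ b :+ c) :+ (la :+ lb :+ lc)) refl

packable16⇒total≤48 : {xs : List Size} → Packable16 xs → total xs ≤ q 48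
packable16⇒total≤48 {xs} (p , refl , fits) = begin
  total (items p)                    ≡⟨ sym (load-total p) ⟩
  load A p + load B p + load C p     ≤⟨ +-mono-≤ (+-mono-≤ (fits A) (fits B)) (fits C) ⟩
  q 48                               ∎
  where open ≤-Reasoning

allInto : Bin → OnlineAlg
allInto X _ _ = X

load-run-allInto-self : (X : Bin) (p : Packing) (xs : List Size) →
  load X (run (allInto X) p xs) ≡ load X p + total xs
load-run-allInto-self X p []       = sym (+-identityʳ (load X p))
load-run-allInto-self X p (x ∷ xs) = begin
  load X (run (allInto X) ((X , x) ∷ p) xs)  ≡⟨ load-run-allInto-self X ((X , x) ∷ p) xs ⟩
  (sameBin X X x + load X p) + total xs      ≡⟨ cong (λ y → (y + load X p) + total xs) (sameBin-self X x) ⟩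
  (x + load X p) + total xs                  ≡⟨ shift x (load X p) (total xs) ⟩
  load X p + (x + total xs)                  ∎
  where
  open ≡-Reasoning
  shift : (x l t : ℚ) → (x + l) + t ≡ l + (x + t)
  shift = solve 3 (λ x l t → (x :+ l) :+ t := l :+ (x :+ t)) refl

load-run-allInto-other : {X Y : Bin} → Y ≢ X → (p : Packing) (xs : List Size) →
  load Y (run (allInto X) p xs) ≡ load Y p
load-run-allInto-other         Y≢X p []       = refl
load-run-allInto-other {X} {Y} Y≢X p (x ∷ xs) = begin
  load Y (run (allInto X) ((X , x) ∷ p) xs)  ≡⟨ load-run-allInto-other Y≢X ((X , x) ∷ p) xs ⟩
  sameBin Y X x + load Y p                   ≡⟨ cong (_+ load Y p) (sameBin-≢ Y≢X x) ⟩
  0ℚ + load Y p                              ≡⟨ +-identityˡ (load Y p) ⟩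
  load Y p                                   ∎
  where open ≡-Reasoning

p+q≤r⇒s≤p⇒q≤r-s : {p q r s : ℚ} → p + q ≤ r → s ≤ p → q ≤ r - s
p+q≤r⇒s≤p⇒q≤r-s {p} {q} {r} {s} p+q≤r s≤p = begin
  q                ≡⟨ cancel p q ⟩
  (p + q) - p      ≤⟨ +-mono-≤ p+q≤r (neg-antimono-≤ s≤p) ⟩
  r - s            ∎
  where
  open ≤-Reasoning
  cancel : (p q : ℚ) → q ≡ (p + q) - p
  cancel = solve 2 (λ p q → q := (p :+ q) :- p) refl

mainTheorem4 : (P : Packing) → All (λ it → InRange (proj₂ it)) P →
    load A P ≤ q 22 → load B P ≤ q 22 → load C P ≤ q 22 →
    q 26 ≤ load A P + load B P →
    ∃ λ (alg : OnlineAlg) → (seq : List Size) → All InRange seq →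
    Packable16 (items P ++ seq) →
    (X : Bin) → load X (run alg P seq) ≤ q 22
mainTheorem4 P _ A≤22 B≤22 _ 26≤A+B = allInto C , bounded
  where
  bounded : (seq : List Size) → All InRange seq → Packable16 (items P ++ seq) →
    (X : Bin) → load X (run (allInto C) P seq) ≤ q 22
  bounded seq _ _  A = subst (_≤ q 22) (sym (load-run-allInto-other (λ ()) P seq)) A≤22
  bounded seq _ _  B = subst (_≤ q 22) (sym (load-run-allInto-other (λ ()) P seq)) B≤22
  bounded seq _ fits C = subst (_≤ q 22) (sym (load-run-allInto-self C P seq))
    (p+q≤r⇒s≤p⇒q≤r-s volume≤48 26≤A+B)
    where
    open ≡-Reasoning
    volume : total (items P ++ seq) ≡ (load A P + load B P) + (load C P + total seq)
    volume = begin
      total (items P ++ seq)                                 ≡⟨ total-++ (items P) seq ⟩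
      total (items P) + total seq                            ≡⟨ cong (_+ total seq) (sym (load-total P)) ⟩
      (load A P + load B P + load C P) + total seq           ≡⟨ +-assoc (load A P + load B P) (load C P) (total seq) ⟩
      (load A P + load B P) + (load C P + total seq)         ∎
    volume≤48 : (load A P + load B P) + (load C P + total seq) ≤ q 48
    volume≤48 = subst (_≤ q 48) volume (packable16⇒total≤48 fits)
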